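{- Let $P_n$ be a path of order $n\ge 3$. Then $\chi_i'(P_n\,\Box\, K_2)=3$.
   Context: $G\,\Box\,H$ denotes the Cartesian product: vertex set $V(G)\times V(H)$, with $(g_1,h_1)$ adjacent to $(g_2,h_2)$ iff either $g_1=g_2$ and $h_1h_2\in E(H)$, or $h_1=h_2$ and $g_1g_2\in E(G)$. Three edges $e_1,e_2,e_3$ (in this order) are consecutive if $e_1=xy$, $e_2=yz$, $e_3=zu$ for some vertices $x,y,z,u$ (where $x=u$ is allowed). An injective edge coloring of $G$ is a map $c:E(G)\to\mathcal{C}$ such that whenever $e_1,e_2,e_3$ are consecutive edges, $c(e_1)\neq c(e_3)$. $\chi_i'(G)$ is the minimum number of colors in an injective edge coloring of $G$. -}

module Defs where

open import Data.Nat using (ℕ; suc; _≥_)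
open import Data.Fin using (Fin; toℕ)
open import Data.Product using (_×_; Σ)
open import Data.Sum using (_⊎_)
open import Relation.Binary.PropositionalEquality using (_≡_)
open import Relation.Nullary using (¬_)

record Graph : Set₁ where
  field
    V       : Set
    Adj     : V → V → Set
    symAdj  : ∀ {x y} → Adj x y → Adj y x
    irrefl  : ∀ {x} → ¬ Adj x x

open Graph public

Path : ℕ → Graph
Path n = record
  { V = Fin n
  ; Adj = λ i j → (suc (toℕ i) ≡ toℕ j) ⊎ (suc (toℕ j) ≡ toℕ i)
  ; symAdj = λ { (Data.Sum.inj₁ p) → Data.Sum.inj₂ p ; (Data.Sum.inj₂ p) → Data.Sum.inj₁ p }
  ; irrefl = irr
  }
  where
  open import Data.Nat.Properties using (1+n≢n)
  open import Relation.Binary.PropositionalEquality using (sym)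
  irr : ∀ {x : Fin n} → ¬ ((suc (toℕ x) ≡ toℕ x) ⊎ (suc (toℕ x) ≡ toℕ x))
  irr {x} (Data.Sum.inj₁ p) = 1+n≢n p
  irr {x} (Data.Sum.inj₂ p) = 1+n≢n p

Complete : ℕ → Graph
Complete n = record
  { V = Fin n ; Adj = λ i j → ¬ i ≡ j
  ; symAdj = λ ne eq → ne (Relation.Binary.PropositionalEquality.sym eq)
  ; irrefl = λ ne → ne Relation.Binary.PropositionalEquality.refl }

_□_ : Graph → Graph → Graph
G □ H = record
  { V = V G × V H
  ; Adj = λ p q → (Data.Product.proj₁ p ≡ Data.Product.proj₁ q × Adj H (Data.Product.proj₂ p) (Data.Product.proj₂ q))
                ⊎ (Data.Product.proj₂ p ≡ Data.Product.proj₂ q × Adj G (Data.Product.proj₁ p) (Data.Product.proj₁ q))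
  ; symAdj = λ { (Data.Sum.inj₁ (e , a)) → Data.Sum.inj₁ (Relation.Binary.PropositionalEquality.sym e , symAdj H a)
               ; (Data.Sum.inj₂ (e , a)) → Data.Sum.inj₂ (Relation.Binary.PropositionalEquality.sym e , symAdj G a) }
  ; irrefl = λ { (Data.Sum.inj₁ (_ , a)) → irrefl H a ; (Data.Sum.inj₂ (_ , a)) → irrefl G a }
  }
  where open Data.Product using (_,_)

-- An edge coloring with colors in C: a color for each adjacent ordered pair,
-- independent of orientation (so it is a function on edges {x,y}).
record EdgeColoring (G : Graph) (C : Set) : Set where
  field
    col  : ∀ x y → Adj G x y → C
    symm : ∀ x y (a : Adj G x y) (b : Adj G y x) → col x y a ≡ col y x b
open EdgeColoring public

-- Injective: for consecutive edges xy, yz, zu (three distinct edges, x = u allowed),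
-- the colors of xy and zu differ.  Distinctness of the three edges amounts to
-- x ≠ z and y ≠ u (y ≠ z holds by adjacency).
Injective : (G : Graph) {C : Set} → EdgeColoring G C → Set
Injective G c = ∀ x y z u (a : Adj G x y) (b : Adj G y z) (d : Adj G z u) →
  ¬ x ≡ z → ¬ y ≡ u → ¬ col c x y a ≡ col c z u d

HasInjectiveColoring : Graph → ℕ → Set
HasInjectiveColoring G k = Σ (EdgeColoring G (Fin k)) (Injective G)

InjChromaticIndex : Graph → ℕ → Set
InjChromaticIndex G k = HasInjectiveColoring G k × (∀ m → HasInjectiveColoring G m → k Data.Nat.≤ m)

module Submission where

-- Pₙ □ K₂ sits inside the infinite ladder on ℕ × Fin 2, whose
-- edges are the rungs (i,0)(i,1) and the rails (i,b)(i+1,b).  We colour the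
-- ladder with three colours: rung i gets i mod 3, and each rail follows a
-- pattern of period 6.  All colour constraints then compare periodic
-- sequences, so each reduces to a finite check on the residues 0,…,5.
-- Since injective colourings pull back along vertex-injective graph
-- homomorphisms, the ladder colouring restricts to Pₙ □ K₂ for every n.
--
-- For n ≥ 3 the rails (0,0)(1,0), (0,1)(1,1) and the rung at 2
-- are pairwise joined by an edge forming three consecutive edges, so any
-- injective colouring gives them three distinct colours.

open import Defs
open import Data.Nat using (ℕ; zero; suc; _+_; _≤_; _≥_; s≤s)
open import Data.Fin using (Fin; zero; suc; toℕ; _≟_; #_)
open import Data.Fin.Properties using (toℕ-injective; all?; injective⇒≤)
open import Data.Product using (_×_; _,_)
open import Data.Product.Properties using (,-injective)
open import Data.Sum using (inj₁; inj₂)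
open import Data.Empty using (⊥-elim)
import Function.Definitions as Fun
open import Relation.Nullary using (¬_; Dec)
open import Relation.Nullary.Decidable using (True; toWitness; ¬?)
open import Relation.Binary.PropositionalEquality
  using (_≡_; _≢_; refl; sym; trans; cong; cong₂; subst; ≢-sym)

record Embedding (G H : Graph) : Set where
  field
    vertex    : V G → V H
    injective : ∀ {x y} → vertex x ≡ vertex y → x ≡ y
    edge      : ∀ {x y} → Adj G x y → Adj H (vertex x) (vertex y)
open Embedding

pullback : ∀ {G H C} → Embedding G H → EdgeColoring H C → EdgeColoring G C
pullback e c = record
  { col  = λ x y a → col c (vertex e x) (vertex e y) (edge e a)
  ; symm = λ x y a b → symm c _ _ (edge e a) (edge e b) }

-- Consecutive edges of G map to consecutive edges of H (injectivity keeps
-- the three image edges distinct), so the pullback stays injective.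
pullback-injective : ∀ {G H C} (e : Embedding G H) (c : EdgeColoring H C) →
  Injective H c → Injective G (pullback e c)
pullback-injective e c c-inj x y z u a b d x≢z y≢u =
  c-inj _ _ _ _ (edge e a) (edge e b) (edge e d)
    (λ eq → x≢z (injective e eq)) (λ eq → y≢u (injective e eq))

LadderVertex : Set
LadderVertex = ℕ × Fin 2

data Step : LadderVertex → LadderVertex → Set where
  rung : ∀ {i b c} → b ≢ c → Step (i , b) (i , c)
  up   : ∀ {i b} → Step (i , b) (suc i , b)
  down : ∀ {i b} → Step (suc i , b) (i , b)

step-sym : ∀ {x y} → Step x y → Step y x
step-sym (rung b≢c) = rung (≢-sym b≢c)
step-sym up         = down
step-sym down       = up

step-irrefl : ∀ {x} → ¬ Step x x
step-irrefl (rung b≢b) = b≢b refl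

Ladder : Graph
Ladder = record { V = LadderVertex ; Adj = Step ; symAdj = step-sym ; irrefl = step-irrefl }

ladder-step : ∀ {n i j b c} → Adj (Path n □ Complete 2) (i , b) (j , c) →
  Step (toℕ i , b) (toℕ j , c)
ladder-step                 (inj₁ (refl , b≢c))      = rung b≢c
ladder-step {i = i} {b = b} (inj₂ (refl , inj₁ i+1≡j)) =
  subst (λ k → Step (toℕ i , b) (k , b)) i+1≡j up
ladder-step {j = j} {b = b} (inj₂ (refl , inj₂ j+1≡i)) =
  subst (λ k → Step (k , b) (toℕ j , b)) j+1≡i down

ladder-embedding : ∀ n → Embedding (Path n □ Complete 2) Ladder
ladder-embedding n = record
  { vertex    = λ { (i , b) → toℕ i , b }
  ; injective = λ eq → let (i≡j , b≡c) = ,-injective eq in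
                       cong₂ _,_ (toℕ-injective i≡j) b≡c
  ; edge      = ladder-step }

six-periodic : {P : ℕ → Set} → (∀ i → P i → P (6 + i)) →
  (∀ (r : Fin 6) → P (toℕ r)) → ∀ i → P i
six-periodic step base 0 = base zero
six-periodic step base 1 = base (suc zero)
six-periodic step base 2 = base (suc (suc zero))
six-periodic step base 3 = base (suc (suc (suc zero)))
six-periodic step base 4 = base (suc (suc (suc (suc zero))))
six-periodic step base 5 = base (suc (suc (suc (suc (suc zero)))))
six-periodic step base (suc (suc (suc (suc (suc (suc i)))))) =
  step i (six-periodic step base i)

Periodic : ∀ {k} → (ℕ → Fin k) → Set
Periodic f = ∀ i → f (6 + i) ≡ f i

-- Two 6-periodic colour sequences differ everywhere if they differ on 0,…,5;
-- the latter is decided by computation.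
apart : ∀ {k} (f g : ℕ → Fin k) → Periodic f → Periodic g →
  {_ : True (all? (λ r → ¬? (f (toℕ r) ≟ g (toℕ r))))} → ∀ i → f i ≢ g i
apart f g f-per g-per {check} = six-periodic shift (toWitness {a? = differ?} check)
  where
  differ? : Dec (∀ (r : Fin 6) → f (toℕ r) ≢ g (toℕ r))
  differ? = all? (λ r → ¬? (f (toℕ r) ≟ g (toℕ r)))

  shift : ∀ i → f i ≢ g i → f (6 + i) ≢ g (6 + i)
  shift i fi≢gi eq = fi≢gi (trans (sym (f-per i)) (trans eq (g-per i)))

R : ℕ → Fin 3
R 0 = # 0
R 1 = # 1
R 2 = # 2
R (suc (suc (suc i))) = R i

T : Fin 2 → ℕ → Fin 3
T zero 0 = # 0
T zero 1 = # 2
T zero 2 = # 2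
T zero 3 = # 1
T zero 4 = # 1
T zero 5 = # 0
T (suc zero) 0 = # 1
T (suc zero) 1 = # 1
T (suc zero) 2 = # 0
T (suc zero) 3 = # 0
T (suc zero) 4 = # 2
T (suc zero) 5 = # 2
T b (suc (suc (suc (suc (suc (suc i)))))) = T b i

step-colour : ∀ {x y} → Step x y → Fin 3
step-colour (rung {i} _)  = R i
step-colour (up {i} {b})   = T b i
step-colour (down {i} {b}) = T b i

step-colour-sym : ∀ {x y} (a : Step x y) (b : Step y x) → step-colour a ≡ step-colour b
step-colour-sym (rung _) (rung _) = refl
step-colour-sym up       down     = refl
step-colour-sym down     up       = refl

-- The separations required by the injectivity condition, one for each
-- relative position of two edges joined by a third.
rungs-apart : ∀ i → R i ≢ R (1 + i)
rungs-apart = apart R (λ i → R (1 + i)) (λ _ → refl) (λ _ → refl)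

rung-next-rail : ∀ b i → R i ≢ T b (1 + i)
rung-next-rail zero       = apart R (λ i → T zero (1 + i)) (λ _ → refl) (λ _ → refl)
rung-next-rail (suc zero) = apart R (λ i → T (suc zero) (1 + i)) (λ _ → refl) (λ _ → refl)

rail-rung-after : ∀ b i → T b i ≢ R (2 + i)
rail-rung-after zero       = apart (T zero) (λ i → R (2 + i)) (λ _ → refl) (λ _ → refl)
rail-rung-after (suc zero) = apart (T (suc zero)) (λ i → R (2 + i)) (λ _ → refl) (λ _ → refl)

rail-skip : ∀ b i → T b i ≢ T b (2 + i)
rail-skip zero       = apart (T zero) (λ i → T zero (2 + i)) (λ _ → refl) (λ _ → refl)
rail-skip (suc zero) = apart (T (suc zero)) (λ i → T (suc zero) (2 + i)) (λ _ → refl) (λ _ → refl)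

opposite-rails : ∀ {b c} → b ≢ c → ∀ i → T b i ≢ T c i
opposite-rails {zero}     {zero}     b≢c = λ _ _ → b≢c refl
opposite-rails {zero}     {suc zero} _   = apart (T zero) (T (suc zero)) (λ _ → refl) (λ _ → refl)
opposite-rails {suc zero} {zero}     _   = apart (T (suc zero)) (T zero) (λ _ → refl) (λ _ → refl)
opposite-rails {suc zero} {suc zero} b≢c = λ _ _ → b≢c refl

opposite-rails-shifted : ∀ {b c} → b ≢ c → ∀ i → T b i ≢ T c (1 + i)
opposite-rails-shifted {zero}     {zero}     b≢c = λ _ _ → b≢c refl
opposite-rails-shifted {zero}     {suc zero} _   =
  apart (T zero) (λ i → T (suc zero) (1 + i)) (λ _ → refl) (λ _ → refl)
opposite-rails-shifted {suc zero} {zero}     _   =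
  apart (T (suc zero)) (λ i → T zero (1 + i)) (λ _ → refl) (λ _ → refl)
opposite-rails-shifted {suc zero} {suc zero} b≢c = λ _ _ → b≢c refl

fin2-other : ∀ {a b c : Fin 2} → a ≢ b → b ≢ c → a ≡ c
fin2-other {zero}     {zero}                a≢b _   = ⊥-elim (a≢b refl)
fin2-other {zero}     {suc zero} {zero}     _   _   = refl
fin2-other {zero}     {suc zero} {suc zero} _   b≢c = ⊥-elim (b≢c refl)
fin2-other {suc zero} {zero}     {zero}     _   b≢c = ⊥-elim (b≢c refl)
fin2-other {suc zero} {zero}     {suc zero} _   _   = refl
fin2-other {suc zero} {suc zero}            a≢b _   = ⊥-elim (a≢b refl)

-- Each
-- shape either violates x ≢ z or y ≢ u, or is one of the separations above.
ladder-injective : ∀ {x y z u} (s₁ : Step x y) (s₂ : Step y z) (s₃ : Step z u) →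
  x ≢ z → y ≢ u → step-colour s₁ ≢ step-colour s₃
ladder-injective (rung b≢c) (rung c≢d) _ x≢z _ = ⊥-elim (x≢z (cong (_ ,_) (fin2-other b≢c c≢d)))
ladder-injective (rung {i} _) up (rung _) _ _ = rungs-apart i
ladder-injective (rung {i} _) (up {b = c}) up _ _ = rung-next-rail c i
ladder-injective (rung _) up down _ y≢u = ⊥-elim (y≢u refl)
ladder-injective (rung _) (down {i}) (rung _) _ _ = ≢-sym (rungs-apart i)
ladder-injective (rung _) down up _ y≢u = ⊥-elim (y≢u refl)
ladder-injective (rung _) down (down {i} {c}) _ _ = ≢-sym (rail-rung-after c i)
ladder-injective up (rung b≢c) (rung c≢d) _ y≢u = ⊥-elim (y≢u (cong (_ ,_) (fin2-other b≢c c≢d)))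
ladder-injective (up {i}) (rung b≢c) up _ _ = opposite-rails-shifted b≢c i
ladder-injective (up {i}) (rung b≢c) down _ _ = opposite-rails b≢c i
ladder-injective (up {i} {b}) up (rung _) _ _ = rail-rung-after b i
ladder-injective (up {i} {b}) up up _ _ = rail-skip b i
ladder-injective up up down _ y≢u = ⊥-elim (y≢u refl)
ladder-injective up down _ x≢z _ = ⊥-elim (x≢z refl)
ladder-injective down (rung b≢c) (rung c≢d) _ y≢u = ⊥-elim (y≢u (cong (_ ,_) (fin2-other b≢c c≢d)))
ladder-injective (down {i}) (rung b≢c) up _ _ = opposite-rails b≢c i
ladder-injective down (rung b≢c) (down {i}) _ _ = ≢-sym (opposite-rails-shifted (≢-sym b≢c) i)
ladder-injective down up _ x≢z _ = ⊥-elim (x≢z refl)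
ladder-injective (down {b = b}) (down {i}) (rung _) _ _ = ≢-sym (rung-next-rail b i)
ladder-injective down down up _ y≢u = ⊥-elim (y≢u refl)
ladder-injective down (down {b = b}) (down {i}) _ _ = ≢-sym (rail-skip b i)

ladder-colouring : EdgeColoring Ladder (Fin 3)
ladder-colouring = record
  { col  = λ _ _ → step-colour
  ; symm = λ _ _ → step-colour-sym }

ladder-colouring-injective : Injective Ladder ladder-colouring
ladder-colouring-injective _ _ _ _ = ladder-injective

ladder-3-colourable : ∀ n → HasInjectiveColoring (Path n □ Complete 2) 3
ladder-3-colourable n =
    pullback (ladder-embedding n) ladder-colouring
  , pullback-injective (ladder-embedding n) ladder-colouring ladder-colouring-injective

three-distinct : ∀ {m} {a b c : Fin m} → a ≢ b → a ≢ c → b ≢ c → 3 ≤ m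
three-distinct {m} {a} {b} {c} a≢b a≢c b≢c = injective⇒≤ pick-injective
  where
  pick : Fin 3 → Fin m
  pick zero             = a
  pick (suc zero)       = b
  pick (suc (suc zero)) = c

  pick-injective : Fun.Injective _≡_ _≡_ pick
  pick-injective {zero}             {zero}             _  = refl
  pick-injective {zero}             {suc zero}         eq = ⊥-elim (a≢b eq)
  pick-injective {zero}             {suc (suc zero)}   eq = ⊥-elim (a≢c eq)
  pick-injective {suc zero}         {zero}             eq = ⊥-elim (a≢b (sym eq))
  pick-injective {suc zero}         {suc zero}         _  = refl
  pick-injective {suc zero}         {suc (suc zero)}   eq = ⊥-elim (b≢c eq)
  pick-injective {suc (suc zero)}   {zero}             eq = ⊥-elim (a≢c (sym eq))
  pick-injective {suc (suc zero)}   {suc zero}         eq = ⊥-elim (b≢c (sym eq))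
  pick-injective {suc (suc zero)}   {suc (suc zero)}   _  = refl

ladder-needs-three : ∀ {n m} → n ≥ 3 → HasInjectiveColoring (Path n □ Complete 2) m → 3 ≤ m
ladder-needs-three {suc zero}       (s≤s ())
ladder-needs-three {suc (suc zero)} (s≤s (s≤s ()))
ladder-needs-three {suc (suc (suc k))} _ (c , c-inj) =
  three-distinct lower≢upper lower≢rung upper≢rung
  where
  L : Graph
  L = Path (suc (suc (suc k))) □ Complete 2

  p₀ p₁ p₂ : Fin (suc (suc (suc k)))
  p₀ = zero
  p₁ = suc zero
  p₂ = suc (suc zero)

  bottom top : Fin 2
  bottom = zero
  top    = suc zero

  rail₀₁ : ∀ b → Adj L (p₀ , b) (p₁ , b)
  rail₀₁ b = inj₂ (refl , inj₁ refl)

  rail₁₀ : ∀ b → Adj L (p₁ , b) (p₀ , b)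
  rail₁₀ b = inj₂ (refl , inj₂ refl)

  rail₁₂ : ∀ b → Adj L (p₁ , b) (p₂ , b)
  rail₁₂ b = inj₂ (refl , inj₁ refl)

  rung↑ : ∀ p → Adj L (p , bottom) (p , top)
  rung↑ p = inj₁ (refl , λ ())

  rung↓ : ∀ p → Adj L (p , top) (p , bottom)
  rung↓ p = inj₁ (refl , λ ())

  lower≢upper : col c _ _ (rail₀₁ bottom) ≢ col c _ _ (rail₀₁ top)
  lower≢upper eq = c-inj _ _ _ _ (rail₁₀ bottom) (rung↑ p₀) (rail₀₁ top) (λ ()) (λ ())
    (trans (sym (symm c _ _ (rail₀₁ bottom) (rail₁₀ bottom))) eq)

  lower≢rung : col c _ _ (rail₀₁ bottom) ≢ col c _ _ (rung↑ p₂)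
  lower≢rung = c-inj _ _ _ _ (rail₀₁ bottom) (rail₁₂ bottom) (rung↑ p₂) (λ ()) (λ ())

  upper≢rung : col c _ _ (rail₀₁ top) ≢ col c _ _ (rung↑ p₂)
  upper≢rung eq = c-inj _ _ _ _ (rail₀₁ top) (rail₁₂ top) (rung↓ p₂) (λ ()) (λ ())
    (trans eq (symm c _ _ (rung↑ p₂) (rung↓ p₂)))

proposition18 : (n : ℕ) → n ≥ 3 → InjChromaticIndex (Path n □ Complete 2) 3
proposition18 n n≥3 = ladder-3-colourable n , λ m → ladder-needs-three n≥3
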